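{- In the setting below, let $i\in M\setminus H_2$. Then every job $j$ that an optimal schedule assigns to machine $i$ has processing requirement $p_j\le 2^{ -c/6+2}$.
   Context: Setting: machines $M=\{1,\dots,m\}$ with speeds $s_1\ge s_2\ge\dots\ge s_m>0$ (unrestricted related machines), jobs with processing requirements $p_j\in[0,1]$; job $j$ on machine $i$ takes time $p_j/s_i$. For a schedule, $J_i$ is the set of jobs on machine $i$ and $L_i=\sum_{j\in J_i}p_j/s_i$ its load. $C^*>0$ is the optimal makespan; an optimal schedule is one with makespan $C^*$. Fix a schedule $\sigma$ with makespan $C_{\max}(\sigma)$ that is a near list schedule: the jobs are indexed $1,\dots,n$ such that, with $J_{i,j}=J_i\cap\{1,\dots,j\}$, for all machines $i'\ne i$ and all $j\in J_i$: $L_{i'}+p_j/s_{i'}\ge L_i-\sum_{\ell\in J_{i,j-1}}p_\ell/s_i$ (all of $J_i,L_i,J_{i,j}$ refer to $\sigma$). Let $c=\lfloor C_{\max}(\sigma)/C^*\rfloor-1$. For each integer $k$ let $H_k=\{i\in M: L_{i'}\ge kC^*\text{ for all }i'\le i\}$ (an initial segment of $M$; $H_k=M$ for $k\le0$).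
   Formalization: The machine speeds $s_i$, the processing requirements $p_j$ and the optimal makespan $C^*$ are rational numbers. -}

module Defs where

open import Data.Nat as ℕ using (ℕ; zero; suc)
open import Data.Integer as ℤ using (ℤ; +_; -[1+_])
open import Data.Rational as ℚ using (ℚ; 0ℚ; 1ℚ; _+_; _*_; _-_; _÷_; _≤_; _<_; Positive)
open import Data.Rational.Properties using (pos⇒nonZero)
open import Data.Fin as Fin using (Fin)
open import Data.Bool using (Bool; true; false; if_then_else_; _∧_)
open import Data.Product using (Σ; _×_; ∃)
open import Relation.Nullary using (¬_; does)
open import Relation.Binary.PropositionalEquality using (_≡_; _≢_)

Σ[_] : ∀ {n} → (Fin n → ℚ) → ℚ
Σ[_] {zero}  f = 0ℚ
Σ[_] {suc n} f = f Fin.zero + Σ[ (λ j → f (Fin.suc j)) ]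

-- maximum of f i over i : Fin m (0 for m = 0; all loads are nonnegative)
Max[_] : ∀ {m} → (Fin m → ℚ) → ℚ
Max[_] {zero}  f = 0ℚ
Max[_] {suc m} f = f Fin.zero ℚ.⊔ Max[ (λ i → f (Fin.suc i)) ]

_^_ : ℚ → ℕ → ℚ
q ^ zero  = 1ℚ
q ^ suc n = q * (q ^ n)

two : ℚ
two = 1ℚ + 1ℚ

-- "p ≤ 2^(-c/6 + 2)" for p ≥ 0, stated as p^6 ≤ 2^(12 - c)
-- (both sides raised to the 6th power; c an integer, negative
-- exponents cleared by multiplying through).
Le2Pow : ℚ → ℤ → Set
Le2Pow p (+ n)     = (p ^ 6) * (two ^ n) ≤ two ^ 12
Le2Pow p -[1+ n ] = p ^ 6 ≤ two ^ (12 ℕ.+ suc n)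

record Machines (m : ℕ) : Set where
  field
    speed     : Fin m → ℚ
    speed-pos : ∀ i → Positive (speed i)
    speed-mon : ∀ {i i'} → i Fin.≤ i' → speed i' ≤ speed i

open Machines public

Schedule : ℕ → ℕ → Set
Schedule n m = Fin n → Fin m

module _ {m n : ℕ} (M : Machines m) (p : Fin n → ℚ) where

  _/s_ : ℚ → Fin m → ℚ
  x /s i = (x ÷ speed M i) {{pos⇒nonZero (speed M i) {{speed-pos M i}}}}

  load : Schedule n m → Fin m → ℚ
  load σ i = Σ[ (λ j → if does (σ j Fin.≟ i) then p j else 0ℚ) ] /s i

  loadBefore : Schedule n m → Fin m → Fin n → ℚ
  loadBefore σ i j =
    Σ[ (λ ℓ → if does (σ ℓ Fin.≟ i) ∧ does (ℓ Fin.<? j) then p ℓ else 0ℚ) ] /s i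

  makespan : Schedule n m → ℚ
  makespan σ = Max[ load σ ]

  IsOptimalMakespan : ℚ → Set
  IsOptimalMakespan C = (∃ λ τ → makespan τ ≡ C) × (∀ τ → C ≤ makespan τ)

  NearList : Schedule n m → Set
  NearList σ = ∀ i i' j → i' ≢ i → σ j ≡ i →
    load σ i - loadBefore σ i j ≤ load σ i' + (p j /s i')

  InH : Schedule n m → ℚ → ℤ → Fin m → Set
  InH σ C k i = ∀ i' → i' Fin.≤ i → (k ℚ./ 1) * C ≤ load σ i'

-- Write C for C*, s for the speeds and L for the loads of σ. As i ∉ H₂ there is a machine
-- i₀ ≤ i with L i₀ < 2C, and a job that τ puts on i has p ≤ C s i ≤ C s i₀. Fix a machine a
-- with L a ≤ ℓ and call a job large if p > θ = 2C s a. By the near-list property the small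
-- jobs on any machine g of σ have total at most (ℓ + 2C) s g, so a machine with load above
-- ℓ + 3C carries more large work in σ than its whole capacity C s g in τ, while τ puts no
-- large job on a machine with s g ≤ 2 s a. The total large work being the same in σ and τ,
-- such an overloaded machine forces a machine g with s g > 2 s a and L g ≤ ℓ + 3C, and it
-- forces θ < 1 as p ≤ 1. Starting from i₀ this yields machines of speed ≥ 2ᵏ s i₀ and load
-- ≤ (3k + 2)C for as long as C_max(σ) > (3k + 2)C; hence p ≤ C s i₀ < 2⁻ᵏ with k ≈ c/3.

module Submission where

open import Defs
open import Data.Nat using (ℕ)
open import Data.Integer as ℤ using (ℤ)
open import Data.Rational as ℚ using (ℚ; 0ℚ; 1ℚ; _≤_; _<_; _÷_; floor)
open import Data.Rational.Properties using (pos⇒nonZero)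
open import Data.Fin using (Fin)
open import Data.Product using (_×_)
open import Relation.Nullary using (¬_)
open import Relation.Binary.PropositionalEquality using (_≡_)

open import Algebra.Bundles using (CommutativeRing)
open import Data.Bool using (Bool; true; false; T; not; _∧_; if_then_else_)
open import Data.Bool.Properties using (T?; T-∧)
open import Data.Empty using (⊥-elim)
open import Data.Fin as Fin using (zero; suc)
import Data.Fin.Properties as Finₚ
open import Data.Integer using (+_; -[1+_])
import Data.Integer.Properties as ℤₚ
open import Data.Integer.DivMod using (a≡a%n+[a/n]*n)
open import Data.Nat as ℕ using (zero; suc; z≤n; s≤s)
import Data.Nat.Properties as ℕₚ
open import Data.Product using (∃; ∃-syntax; _,_; proj₁; proj₂)
open import Data.Rational using (Positive; NonZero; nonNegative; _+_; _*_; _-_; 1/_; *≤*; *<*)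
open import Data.Rational.Literals using (fromℤ)
open import Data.Rational.Properties
open import Data.Rational.Solver using (module +-*-Solver)
open import Data.Sum using (_⊎_; inj₁; inj₂; [_,_]′)
open import Function using (_∘_; Equivalence)
open import Relation.Nullary using (Dec; yes; no; does)
open import Relation.Nullary.Decidable using (_×-dec_; _→-dec_)
open import Relation.Binary.PropositionalEquality
  using (refl; sym; trans; cong; cong₂; subst; subst₂; module ≡-Reasoning)
open import Algebra.Properties.CommutativeMonoid.Sum +-0-commutativeMonoid
  using (sum; sum-cong-≗; sum-replicate-zero; ∑-distrib-+; ∑-comm)
open import Algebra.Properties.CommutativeSemiring.Exp
  (CommutativeRing.commutativeSemiring +-*-commutativeRing)
  using (^-homo-*; ^-assocʳ; ^-distrib-*) renaming (_^_ to _^ᴿ_)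

open +-*-Solver

does-sound : ∀ {A : Set} (a? : Dec A) → T (does a?) → A
does-sound (yes a) _ = a

does-complete : ∀ {A : Set} (a? : Dec A) → A → T (does a?)
does-complete (yes _)  _ = _
does-complete (no ¬a) a = ¬a a

does-refute : ∀ {A : Set} (a? : Dec A) → T (not (does a?)) → ¬ A
does-refute (no ¬a) _ = ¬a

<⇒≱ : ∀ {x y} → x < y → ¬ y ≤ x
<⇒≱ x<y y≤x = <-irrefl refl (<-≤-trans x<y y≤x)

+-cancelʳ-< : ∀ {x y} z → x + z < y + z → x < y
+-cancelʳ-< {x} {y} z x+z<y+z with x <? y
... | yes x<y = x<y
... | no  x≮y = ⊥-elim (<⇒≱ x+z<y+z (+-monoˡ-≤ z (≮⇒≥ x≮y)))

*-nonNeg : ∀ {x y} → 0ℚ ≤ x → 0ℚ ≤ y → 0ℚ ≤ x * y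
*-nonNeg {x} {y} 0≤x 0≤y =
  nonNegative⁻¹ _ {{nonNeg*nonNeg⇒nonNeg x {{nonNegative 0≤x}} y {{nonNegative 0≤y}}}}

*-monoˡ-≤-0≤ : ∀ {r x y} → 0ℚ ≤ r → x ≤ y → r * x ≤ r * y
*-monoˡ-≤-0≤ {r} 0≤r = *-monoˡ-≤-nonNeg r {{nonNegative 0≤r}}

*-monoʳ-≤-0≤ : ∀ {r x y} → 0ℚ ≤ r → x ≤ y → x * r ≤ y * r
*-monoʳ-≤-0≤ {r} 0≤r = *-monoʳ-≤-nonNeg r {{nonNegative 0≤r}}

x≤x+y : ∀ x {y} → 0ℚ ≤ y → x ≤ x + y
x≤x+y x {y} 0≤y = ≤-trans (≤-reflexive (sym (+-identityʳ x))) (+-monoʳ-≤ x 0≤y)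

y≤x+y : ∀ {x} y → 0ℚ ≤ x → y ≤ x + y
y≤x+y {x} y 0≤x = ≤-trans (≤-reflexive (sym (+-identityˡ y))) (+-monoˡ-≤ y 0≤x)

0≤two : 0ℚ ≤ two
0≤two = *≤* (ℤ.+≤+ z≤n)

module _ (r : ℚ) .{{r>0 : Positive r}} where

  private instance
    r≢0 : NonZero r
    r≢0 = pos⇒nonZero r

  ÷-*-inverse : ∀ x → (x ÷ r) * r ≡ x
  ÷-*-inverse x =
    trans (*-assoc x (1/ r) r) (trans (cong (x *_) (*-inverseˡ r)) (*-identityʳ x))

  ÷≤⇒≤* : ∀ {x y} → x ÷ r ≤ y → x ≤ y * r
  ÷≤⇒≤* {x} x÷r≤y =
    ≤-trans (≤-reflexive (sym (÷-*-inverse x))) (*-monoʳ-≤-nonNeg r {{pos⇒nonNeg r}} x÷r≤y)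

  ≤*⇒÷≤ : ∀ {x y} → x ≤ y * r → x ÷ r ≤ y
  ≤*⇒÷≤ {x} x≤yr = *-cancelʳ-≤-pos r (≤-trans (≤-reflexive (÷-*-inverse x)) x≤yr)

  <÷⇒*< : ∀ {x y} → y < x ÷ r → y * r < x
  <÷⇒*< {x} y<x÷r = <-≤-trans (*-monoˡ-<-pos r y<x÷r) (≤-reflexive (÷-*-inverse x))

  ÷-nonNeg : ∀ {x} → 0ℚ ≤ x → 0ℚ ≤ x ÷ r
  ÷-nonNeg {x} 0≤x = *-cancelʳ-≤-pos r
    (≤-trans (≤-reflexive (*-zeroˡ r)) (≤-trans 0≤x (≤-reflexive (sym (÷-*-inverse x)))))

  ÷-distrib-minus : ∀ x y → x ÷ r - y ÷ r ≡ (x - y) ÷ r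
  ÷-distrib-minus x y =
    solve 3 (λ x y r⁻¹ → x :* r⁻¹ :- y :* r⁻¹ := (x :- y) :* r⁻¹) refl x y (1/ r)

Σ≡sum : ∀ {n} (f : Fin n → ℚ) → Σ[ f ] ≡ sum f
Σ≡sum {zero}  f = refl
Σ≡sum {suc n} f = cong (_+_ (f zero)) (Σ≡sum (f ∘ suc))

Σ-cong : ∀ {n} {f g : Fin n → ℚ} → (∀ j → f j ≡ g j) → Σ[ f ] ≡ Σ[ g ]
Σ-cong {f = f} {g} f≗g = trans (Σ≡sum f) (trans (sum-cong-≗ f≗g) (sym (Σ≡sum g)))

Σ-zero : ∀ n → Σ[ (λ (_ : Fin n) → 0ℚ) ] ≡ 0ℚ
Σ-zero n = trans (Σ≡sum (λ (_ : Fin n) → 0ℚ)) (sum-replicate-zero n)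

Σ-distrib-+ : ∀ {n} (f g : Fin n → ℚ) → Σ[ (λ j → f j + g j) ] ≡ Σ[ f ] + Σ[ g ]
Σ-distrib-+ f g =
  trans (Σ≡sum (λ j → f j + g j))
        (trans (∑-distrib-+ f g) (sym (cong₂ _+_ (Σ≡sum f) (Σ≡sum g))))

Σ-comm : ∀ {m n} (f : Fin m → Fin n → ℚ) →
  Σ[ (λ g → Σ[ f g ]) ] ≡ Σ[ (λ l → Σ[ (λ g → f g l) ]) ]
Σ-comm f = begin
  Σ[ (λ g → Σ[ f g ]) ]             ≡⟨ Σ-cong (λ g → Σ≡sum (f g)) ⟩
  Σ[ (λ g → sum (f g)) ]            ≡⟨ Σ≡sum (λ g → sum (f g)) ⟩
  sum (λ g → sum (f g))             ≡⟨ ∑-comm f ⟩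
  sum (λ l → sum (λ g → f g l))     ≡⟨ sym (Σ≡sum (λ l → sum (λ g → f g l))) ⟩
  Σ[ (λ l → sum (λ g → f g l)) ]    ≡⟨ sym (Σ-cong (λ l → Σ≡sum (λ g → f g l))) ⟩
  Σ[ (λ l → Σ[ (λ g → f g l) ]) ]   ∎
  where open ≡-Reasoning

Σ-mono-≤ : ∀ {n} {f g : Fin n → ℚ} → (∀ j → f j ≤ g j) → Σ[ f ] ≤ Σ[ g ]
Σ-mono-≤ {zero}  f≤g = ≤-refl
Σ-mono-≤ {suc n} f≤g = +-mono-≤ (f≤g zero) (Σ-mono-≤ (f≤g ∘ suc))

Σ-mono-< : ∀ {n} {f g : Fin n → ℚ} → (∀ j → f j ≤ g j) → ∀ k → f k < g k → Σ[ f ] < Σ[ g ]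
Σ-mono-< f≤g zero    fk<gk = +-mono-<-≤ fk<gk (Σ-mono-≤ (f≤g ∘ suc))
Σ-mono-< f≤g (suc k) fk<gk = +-mono-≤-< (f≤g zero) (Σ-mono-< (f≤g ∘ suc) k fk<gk)

Σ-nonNeg : ∀ {n} {f : Fin n → ℚ} → (∀ j → 0ℚ ≤ f j) → 0ℚ ≤ Σ[ f ]
Σ-nonNeg {n} 0≤f = ≤-trans (≤-reflexive (sym (Σ-zero n))) (Σ-mono-≤ 0≤f)

Σ-nonPos : ∀ {n} {f : Fin n → ℚ} → (∀ j → f j ≤ 0ℚ) → Σ[ f ] ≤ 0ℚ
Σ-nonPos {n} f≤0 = ≤-trans (Σ-mono-≤ f≤0) (≤-reflexive (Σ-zero n))

Σ-member : ∀ {n} {f : Fin n → ℚ} → (∀ j → 0ℚ ≤ f j) → ∀ k → f k ≤ Σ[ f ]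
Σ-member {f = f} 0≤f zero    = x≤x+y (f zero) (Σ-nonNeg (0≤f ∘ suc))
Σ-member {f = f} 0≤f (suc k) = ≤-trans (Σ-member (0≤f ∘ suc) k) (y≤x+y _ (0≤f zero))

Σ-positive : ∀ {n} {f : Fin n → ℚ} → 0ℚ < Σ[ f ] → ∃ λ j → 0ℚ < f j
Σ-positive {f = f} 0<Σf with Finₚ.any? (λ j → 0ℚ <? f j)
... | yes ∃0<f = ∃0<f
... | no  ∄0<f = ⊥-elim (<⇒≱ 0<Σf (Σ-nonPos (λ j → ≮⇒≥ (λ 0<fj → ∄0<f (j , 0<fj)))))

if-nonNeg : ∀ b {x} → 0ℚ ≤ x → 0ℚ ≤ (if b then x else 0ℚ)
if-nonNeg true  0≤x = 0≤x
if-nonNeg false _   = ≤-refl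

if-nonPos : ∀ b {x} → (T b → x ≤ 0ℚ) → (if b then x else 0ℚ) ≤ 0ℚ
if-nonPos true  x≤0 = x≤0 _
if-nonPos false _   = ≤-refl

if-mono : ∀ a b {x} → 0ℚ ≤ x → (T a → T b) → (if a then x else 0ℚ) ≤ (if b then x else 0ℚ)
if-mono true  true  _   _   = ≤-refl
if-mono true  false _   a⇒b = ⊥-elim (a⇒b _)
if-mono false b     0≤x _   = if-nonNeg b 0≤x

if-true : ∀ b {x} → T b → (if b then x else 0ℚ) ≡ x
if-true true _ = refl

if-false : ∀ b {x} → ¬ T b → (if b then x else 0ℚ) ≡ 0ℚ
if-false true  ¬Tb = ⊥-elim (¬Tb _)
if-false false _   = refl

if-positive : ∀ b {x} → 0ℚ < (if b then x else 0ℚ) → T b × 0ℚ < x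
if-positive true  0<x = _ , 0<x
if-positive false 0<0 = ⊥-elim (<-irrefl refl 0<0)

if-split : ∀ a b x →
  (if a then x else 0ℚ) ≡ (if a ∧ b then x else 0ℚ) + (if not b ∧ a then x else 0ℚ)
if-split true  true  x = sym (+-identityʳ x)
if-split true  false x = sym (+-identityˡ x)
if-split false true  x = sym (+-identityˡ 0ℚ)
if-split false false x = sym (+-identityˡ 0ℚ)

Σ⟦_⟧_ : ∀ {n} → (Fin n → Bool) → (Fin n → ℚ) → ℚ
Σ⟦ P ⟧ x = Σ[ (λ l → if P l then x l else 0ℚ) ]

infixr 6 _∧ᵖ_

_∧ᵖ_ : ∀ {n} → (Fin n → Bool) → (Fin n → Bool) → Fin n → Bool
(P ∧ᵖ Q) l = P l ∧ Q l

notᵖ : ∀ {n} → (Fin n → Bool) → Fin n → Bool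
notᵖ P l = not (P l)

before : ∀ {n} → Fin n → Fin n → Bool
before j l = does (l Fin.<? j)

module _ {n : ℕ} where

  Σ⟦⟧-nonNeg : ∀ P {x : Fin n → ℚ} → (∀ l → 0ℚ ≤ x l) → 0ℚ ≤ Σ⟦ P ⟧ x
  Σ⟦⟧-nonNeg P 0≤x = Σ-nonNeg (λ l → if-nonNeg (P l) (0≤x l))

  Σ⟦⟧-nonPos : ∀ P {x : Fin n → ℚ} → (∀ l → T (P l) → x l ≤ 0ℚ) → Σ⟦ P ⟧ x ≤ 0ℚ
  Σ⟦⟧-nonPos P x≤0 = Σ-nonPos (λ l → if-nonPos (P l) (x≤0 l))

  Σ⟦⟧-mono : ∀ {P Q} {x : Fin n → ℚ} → (∀ l → 0ℚ ≤ x l) → (∀ l → T (P l) → T (Q l)) →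
    Σ⟦ P ⟧ x ≤ Σ⟦ Q ⟧ x
  Σ⟦⟧-mono {P} {Q} 0≤x P⊆Q = Σ-mono-≤ (λ l → if-mono (P l) (Q l) (0≤x l) (P⊆Q l))

  Σ⟦⟧-member : ∀ P {x : Fin n → ℚ} → (∀ l → 0ℚ ≤ x l) → ∀ j → T (P j) → x j ≤ Σ⟦ P ⟧ x
  Σ⟦⟧-member P {x} 0≤x j Pj =
    subst (_≤ Σ⟦ P ⟧ x) (if-true (P j) Pj) (Σ-member (λ l → if-nonNeg (P l) (0≤x l)) j)

  Σ⟦⟧-positive : ∀ P {x : Fin n → ℚ} → 0ℚ < Σ⟦ P ⟧ x → ∃ λ j → T (P j) × 0ℚ < x j
  Σ⟦⟧-positive P 0<Σ with Σ-positive 0<Σ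
  ... | j , 0<xj = j , if-positive (P j) 0<xj

  Σ⟦⟧-split : ∀ P Q (x : Fin n → ℚ) → Σ⟦ P ⟧ x ≡ Σ⟦ P ∧ᵖ Q ⟧ x + Σ⟦ notᵖ Q ∧ᵖ P ⟧ x
  Σ⟦⟧-split P Q x = trans (Σ-cong (λ l → if-split (P l) (Q l) (x l)))
    (Σ-distrib-+ (λ l → if P l ∧ Q l then x l else 0ℚ)
                 (λ l → if not (Q l) ∧ P l then x l else 0ℚ))

Σ-indicator : ∀ {m} (i : Fin m) b y →
  Σ[ (λ g → if does (i Fin.≟ g) ∧ b then y else 0ℚ) ] ≡ (if b then y else 0ℚ)
Σ-indicator {suc m} zero    b y =
  trans (cong (_+_ (if b then y else 0ℚ)) (Σ-zero m)) (+-identityʳ _)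
Σ-indicator {suc m} (suc i) b y = trans (+-identityˡ _) (Σ-indicator i b y)

Σ⟦⟧-partition : ∀ {m n} (h : Fin n → Fin m) Q (x : Fin n → ℚ) →
  Σ[ (λ g → Σ⟦ (λ l → does (h l Fin.≟ g)) ∧ᵖ Q ⟧ x) ] ≡ Σ⟦ Q ⟧ x
Σ⟦⟧-partition h Q x =
  trans (Σ-comm (λ g l → if does (h l Fin.≟ g) ∧ Q l then x l else 0ℚ))
        (Σ-cong (λ l → Σ-indicator (h l) (Q l) (x l)))

-- The selected sum is at most the tail starting at the first selected index.
Σ⟦⟧-≤-tails : ∀ {n} Q P {x : Fin n → ℚ} {B} → (∀ l → 0ℚ ≤ x l) → 0ℚ ≤ B →
  (∀ j → T (Q j ∧ P j) → Σ⟦ notᵖ (before j) ∧ᵖ P ⟧ x ≤ B) → Σ⟦ Q ∧ᵖ P ⟧ x ≤ B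
Σ⟦⟧-≤-tails {zero}  Q P 0≤x 0≤B tail≤B = 0≤B
Σ⟦⟧-≤-tails {suc n} Q P {x} {B} 0≤x 0≤B tail≤B with T? (Q zero ∧ P zero)
... | yes QP₀ = ≤-trans (Σ⟦⟧-mono 0≤x (λ l → proj₂ ∘ Equivalence.to (T-∧ {Q l} {P l})))
                        (tail≤B zero QP₀)
... | no ¬QP₀ = begin
  Σ⟦ Q ∧ᵖ P ⟧ x                               ≡⟨ cong (_+ rest) (if-false (Q zero ∧ P zero) ¬QP₀) ⟩
  0ℚ + rest                                   ≡⟨ +-identityˡ rest ⟩
  rest                                        ≤⟨ Σ⟦⟧-≤-tails (Q ∘ suc) (P ∘ suc) (0≤x ∘ suc) 0≤B
                                                   (λ j → ≤-trans (y≤x+y _ ≤-refl) ∘ tail≤B (suc j)) ⟩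
  B                                           ∎
  where
  open ≤-Reasoning
  rest : ℚ
  rest = Σ⟦ (Q ∘ suc) ∧ᵖ (P ∘ suc) ⟧ (x ∘ suc)

Max-upperBound : ∀ {m} (f : Fin m → ℚ) i → f i ≤ Max[ f ]
Max-upperBound f zero    = p≤p⊔q (f zero) _
Max-upperBound f (suc i) = ≤-trans (Max-upperBound (f ∘ suc) i) (p≤q⊔p (f zero) _)

<Max⇒∃< : ∀ {m} (f : Fin m → ℚ) {x} → 0ℚ ≤ x → x < Max[ f ] → ∃ λ h → x < f h
<Max⇒∃< {zero}  f 0≤x x<0 = ⊥-elim (<⇒≱ x<0 0≤x)
<Max⇒∃< {suc m} f {x} 0≤x x<Max with ⊔-sel (f zero) Max[ f ∘ suc ]
... | inj₁ Max≡f₀ = zero , subst (x <_) Max≡f₀ x<Max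
... | inj₂ Max≡Max′ with <Max⇒∃< (f ∘ suc) 0≤x (subst (x <_) Max≡Max′ x<Max)
...   | h , x<fh = suc h , x<fh

^≡^ᴿ : ∀ x k → x ^ k ≡ x ^ᴿ k
^≡^ᴿ x zero    = refl
^≡^ᴿ x (suc k) = cong (x *_) (^≡^ᴿ x k)

^-+ : ∀ x a b → x ^ (a ℕ.+ b) ≡ x ^ a * x ^ b
^-+ x a b = trans (^≡^ᴿ x (a ℕ.+ b))
  (trans (^-homo-* x a b) (sym (cong₂ _*_ (^≡^ᴿ x a) (^≡^ᴿ x b))))

^-* : ∀ x a b → x ^ (a ℕ.* b) ≡ (x ^ a) ^ b
^-* x a b = trans (^≡^ᴿ x (a ℕ.* b))
  (trans (sym (^-assocʳ x a b)) (sym (trans (^≡^ᴿ (x ^ a) b) (cong (_^ᴿ b) (^≡^ᴿ x a)))))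

*-^ : ∀ x y k → (x * y) ^ k ≡ x ^ k * y ^ k
*-^ x y k = trans (^≡^ᴿ (x * y) k)
  (trans (^-distrib-* x y k) (sym (cong₂ _*_ (^≡^ᴿ x k) (^≡^ᴿ y k))))

^-nonNeg : ∀ {x} k → 0ℚ ≤ x → 0ℚ ≤ x ^ k
^-nonNeg zero    _   = *≤* (ℤ.+≤+ z≤n)
^-nonNeg (suc k) 0≤x = *-nonNeg 0≤x (^-nonNeg k 0≤x)

^-≤1 : ∀ {x} k → 0ℚ ≤ x → x ≤ 1ℚ → x ^ k ≤ 1ℚ
^-≤1 zero    _   _   = ≤-refl
^-≤1 {x} (suc k) 0≤x x≤1 =
  ≤-trans (*-monoˡ-≤-0≤ 0≤x (^-≤1 k 0≤x x≤1)) (≤-trans (≤-reflexive (*-identityʳ x)) x≤1)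

1≤two^ : ∀ k → 1ℚ ≤ two ^ k
1≤two^ zero    = ≤-refl
1≤two^ (suc k) = begin
  1ℚ                ≤⟨ 1≤two^ k ⟩
  two ^ k           ≤⟨ x≤x+y (two ^ k) (^-nonNeg k 0≤two) ⟩
  two ^ k + two ^ k ≡⟨ solve 1 (λ t → t :+ t := (con 1ℚ :+ con 1ℚ) :* t) refl (two ^ k) ⟩
  two * two ^ k     ∎
  where open ≤-Reasoning

two^-mono : ∀ {a b} → a ℕ.≤ b → two ^ a ≤ two ^ b
two^-mono {a} {b} a≤b = begin
  two ^ a                   ≡⟨ sym (*-identityʳ (two ^ a)) ⟩
  two ^ a * 1ℚ              ≤⟨ *-monoˡ-≤-0≤ (^-nonNeg a 0≤two) (1≤two^ (b ℕ.∸ a)) ⟩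
  two ^ a * two ^ (b ℕ.∸ a) ≡⟨ sym (^-+ two a (b ℕ.∸ a)) ⟩
  two ^ (a ℕ.+ (b ℕ.∸ a))   ≡⟨ cong (two ^_) (ℕₚ.m+[n∸m]≡n a≤b) ⟩
  two ^ b                   ∎
  where open ≤-Reasoning

fromℕ : ℕ → ℚ
fromℕ k = fromℤ (+ k)

fromℕ-+ : ∀ a b → fromℕ (a ℕ.+ b) ≡ fromℕ a + fromℕ b
fromℕ-+ a b = sym (trans
  (cong₂ (λ u v → (u ℤ.+ v) ℚ./ 1) (ℤₚ.*-identityʳ (+ a)) (ℤₚ.*-identityʳ (+ b)))
  (normalize-coprime _))

fromℕ-nonNeg : ∀ k → 0ℚ ≤ fromℕ k
fromℕ-nonNeg k = nonNegative⁻¹ (fromℕ k)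

fromℕ-< : ∀ {a b} → a ℕ.< b → fromℕ a < fromℕ b
fromℕ-< {a} {b} a<b =
  *<* (subst₂ ℤ._<_ (sym (ℤₚ.*-identityʳ (+ a))) (sym (ℤₚ.*-identityʳ (+ b))) (ℤ.+<+ a<b))

floor-≤ : ∀ x {k} → floor x ≡ + k → fromℕ k ≤ x
floor-≤ x@record{} floor≡k = *≤* (subst₂ ℤ._≤_
  (cong (ℤ._* ℚ.↧ x) floor≡k)
  (sym (trans (ℤₚ.*-identityʳ (ℚ.↥ x)) (a≡a%n+[a/n]*n (ℚ.↥ x) (ℚ.↧ x))))
  (ℤₚ.i≤j+i _ (+ _)))

exponent-split : ∀ N → N ℕ.≤ 12 ⊎ ∃[ K ] K ℕ.* 3 ℕ.+ 2 ℕ.≤ N × N ℕ.≤ K ℕ.* 6 ℕ.+ 12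
exponent-split zero = inj₁ z≤n
exponent-split (suc N) with exponent-split N
... | inj₁ N≤12 with N ℕₚ.≟ 12
...   | yes refl = inj₂ (1 , ℕₚ.m≤m+n 5 8 , ℕₚ.m≤m+n 13 5)
...   | no  N≢12 = inj₁ (ℕₚ.≤∧≢⇒< N≤12 N≢12)
exponent-split (suc N) | inj₂ (K , lo , hi) with suc N ℕₚ.≤? K ℕ.* 6 ℕ.+ 12
...   | yes hi′ = inj₂ (K , ℕₚ.m≤n⇒m≤1+n lo , hi′)
...   | no  N≰  = inj₂ (suc K , s≤s lo′ , s≤s (ℕₚ.≤-trans hi (ℕₚ.m≤n+m _ 5)))
  where
  open ℕₚ.≤-Reasoning
  lo′ : 2 ℕ.+ (K ℕ.* 3 ℕ.+ 2) ℕ.≤ N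
  lo′ = begin
    2 ℕ.+ (K ℕ.* 3 ℕ.+ 2) ≡⟨ ℕₚ.+-comm 2 _ ⟩
    K ℕ.* 3 ℕ.+ 2 ℕ.+ 2   ≡⟨ ℕₚ.+-assoc (K ℕ.* 3) 2 2 ⟩
    K ℕ.* 3 ℕ.+ 4         ≤⟨ ℕₚ.+-mono-≤ (ℕₚ.*-monoʳ-≤ K (ℕₚ.m≤m+n 3 3)) (ℕₚ.m≤m+n 4 8) ⟩
    K ℕ.* 6 ℕ.+ 12        ≤⟨ ℕₚ.≤-pred (ℕₚ.≰⇒> N≰) ⟩
    N                     ∎

Le2Pow-negative : ∀ {y} k → 0ℚ ≤ y → y ≤ 1ℚ → Le2Pow y -[1+ k ]
Le2Pow-negative k 0≤y y≤1 = ≤-trans (^-≤1 6 0≤y y≤1) (1≤two^ (12 ℕ.+ suc k))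

halvings⇒Le2Pow : ∀ {y} N → 0ℚ ≤ y → y ≤ 1ℚ →
  (∀ K → K ℕ.* 3 ℕ.+ 2 ℕ.≤ N → two ^ K * y ≤ 1ℚ) → Le2Pow y (+ N)
halvings⇒Le2Pow {y} N 0≤y y≤1 halve = [ small-exponent , large-exponent ]′ (exponent-split N)
  where
  open ≤-Reasoning

  small-exponent : N ℕ.≤ 12 → Le2Pow y (+ N)
  small-exponent N≤12 = begin
    y ^ 6 * two ^ N  ≤⟨ *-monoʳ-≤-0≤ (^-nonNeg N 0≤two) (^-≤1 6 0≤y y≤1) ⟩
    1ℚ * two ^ N     ≡⟨ *-identityˡ _ ⟩
    two ^ N          ≤⟨ two^-mono N≤12 ⟩
    two ^ 12         ∎

  large-exponent : ∃[ K ] K ℕ.* 3 ℕ.+ 2 ℕ.≤ N × N ℕ.≤ K ℕ.* 6 ℕ.+ 12 → Le2Pow y (+ N)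
  large-exponent (K , lo , hi) = begin
    y ^ 6 * two ^ N                       ≤⟨ *-monoˡ-≤-0≤ (^-nonNeg 6 0≤y) (two^-mono hi) ⟩
    y ^ 6 * two ^ (K ℕ.* 6 ℕ.+ 12)        ≡⟨ cong (y ^ 6 *_) (^-+ two (K ℕ.* 6) 12) ⟩
    y ^ 6 * (two ^ (K ℕ.* 6) * two ^ 12)  ≡⟨ cong (λ t → y ^ 6 * (t * two ^ 12)) (^-* two K 6) ⟩
    y ^ 6 * ((two ^ K) ^ 6 * two ^ 12)    ≡⟨ solve 3 (λ a b c → a :* (b :* c) := (b :* a) :* c)
                                               refl (y ^ 6) ((two ^ K) ^ 6) (two ^ 12) ⟩
    ((two ^ K) ^ 6 * y ^ 6) * two ^ 12    ≡⟨ cong (_* two ^ 12) (sym (*-^ (two ^ K) y 6)) ⟩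
    (two ^ K * y) ^ 6 * two ^ 12          ≤⟨ *-monoʳ-≤-0≤ (^-nonNeg 12 0≤two)
                                               (^-≤1 6 (*-nonNeg (^-nonNeg K 0≤two) 0≤y) (halve K lo)) ⟩
    1ℚ * two ^ 12                         ≡⟨ *-identityˡ _ ⟩
    two ^ 12                              ∎

Le2Pow-floor : ∀ {y} x → 0ℚ ≤ y → y ≤ 1ℚ →
  (∀ K → fromℕ (K ℕ.* 3 ℕ.+ 2) < x → two ^ K * y ≤ 1ℚ) → Le2Pow y (floor x ℤ.- ℤ.1ℤ)
Le2Pow-floor {y} x 0≤y y≤1 halve = by-floor (floor x) refl
  where
  by-floor : ∀ z → floor x ≡ z → Le2Pow y (z ℤ.- ℤ.1ℤ)
  by-floor -[1+ k ]  _      = Le2Pow-negative (suc (k ℕ.+ 0)) 0≤y y≤1   -- -[1+ k ] - 1 reduces to this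
  by-floor (+ zero)  _      = Le2Pow-negative 0 0≤y y≤1
  by-floor (+ suc N) floor≡ = halvings⇒Le2Pow N 0≤y y≤1
    (λ K lo → halve K (<-≤-trans (fromℕ-< (s≤s lo)) (floor-≤ x floor≡)))

module Scheduling {m n : ℕ} (M : Machines m) (p : Fin n → ℚ) (0≤p : ∀ l → 0ℚ ≤ p l) where

  private
    s : Fin m → ℚ
    s = speed M

    instance
      s-positive : ∀ {g} → Positive (s g)
      s-positive {g} = speed-pos M g

      s-nonZero : ∀ {g} → NonZero (s g)
      s-nonZero {g} = pos⇒nonZero (s g)

  -- load M p π g and loadBefore M p π g j unfold to work π g ÷ s g and
  -- Σ⟦ onMachine π g ∧ᵖ before j ⟧ p ÷ s g.
  onMachine : Schedule n m → Fin m → Fin n → Bool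
  onMachine π g l = does (π l Fin.≟ g)

  work : Schedule n m → Fin m → ℚ
  work π g = Σ⟦ onMachine π g ⟧ p

  large : ℚ → Fin n → Bool
  large θ l = does (θ <? p l)

  largeWork : Schedule n m → ℚ → Fin m → ℚ
  largeWork π θ g = Σ⟦ onMachine π g ∧ᵖ large θ ⟧ p

  onMachine⇒≡ : ∀ {π g l} → T (onMachine π g l) → π l ≡ g
  onMachine⇒≡ {π} {g} {l} = does-sound (π l Fin.≟ g)

  large⇒< : ∀ {θ l} → T (large θ l) → θ < p l
  large⇒< {θ} {l} = does-sound (θ <? p l)

  small⇒≤ : ∀ {θ l} → T (not (large θ l)) → p l ≤ θ
  small⇒≤ {θ} {l} small = ≮⇒≥ (does-refute (θ <? p l) small)

  largeWork-nonNeg : ∀ π θ g → 0ℚ ≤ largeWork π θ g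
  largeWork-nonNeg π θ g = Σ⟦⟧-nonNeg (onMachine π g ∧ᵖ large θ) 0≤p

  largeWork≤work : ∀ π θ g → largeWork π θ g ≤ work π g
  largeWork≤work π θ g =
    Σ⟦⟧-mono 0≤p (λ l → proj₁ ∘ Equivalence.to (T-∧ {onMachine π g l} {large θ l}))

  largeWork≤0 : ∀ π θ g → (∀ l → π l ≡ g → p l ≤ θ) → largeWork π θ g ≤ 0ℚ
  largeWork≤0 π θ g small = Σ⟦⟧-nonPos (onMachine π g ∧ᵖ large θ) λ l on∧large →
    let (on , θ<pl) = Equivalence.to (T-∧ {onMachine π g l} {large θ l}) on∧large
    in  ⊥-elim (<⇒≱ (large⇒< {θ} θ<pl) (small l (onMachine⇒≡ {π} on)))

  largeWork-conserved : ∀ π π′ θ → Σ[ largeWork π θ ] ≡ Σ[ largeWork π′ θ ]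
  largeWork-conserved π π′ θ =
    trans (Σ⟦⟧-partition π (large θ) p) (sym (Σ⟦⟧-partition π′ (large θ) p))

  work≤makespan*speed : ∀ π g → work π g ≤ makespan M p π * s g
  work≤makespan*speed π g = ÷≤⇒≤* (s g) (Max-upperBound (load M p π) g)

  p≤makespan*speed : ∀ π l → p l ≤ makespan M p π * s (π l)
  p≤makespan*speed π l =
    ≤-trans (Σ⟦⟧-member (onMachine π (π l)) 0≤p l (does-complete (π l Fin.≟ π l) refl))
            (work≤makespan*speed π (π l))

  load-loadBefore≡tail : ∀ σ g j →
    load M p σ g - loadBefore M p σ g j ≡ Σ⟦ notᵖ (before j) ∧ᵖ onMachine σ g ⟧ p ÷ s g
  load-loadBefore≡tail σ g j = begin
    work σ g ÷ s g - earlier ÷ s g    ≡⟨ ÷-distrib-minus (s g) (work σ g) earlier ⟩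
    (work σ g - earlier) ÷ s g        ≡⟨ cong (λ w → (w - earlier) ÷ s g)
                                           (Σ⟦⟧-split (onMachine σ g) (before j) p) ⟩
    (earlier + tail - earlier) ÷ s g  ≡⟨ cong (λ w → w ÷ s g)
                                           (solve 2 (λ e t → e :+ t :- e := t) refl earlier tail) ⟩
    tail ÷ s g                        ∎
    where
    open ≡-Reasoning
    earlier tail : ℚ
    earlier = Σ⟦ onMachine σ g ∧ᵖ before j ⟧ p
    tail    = Σ⟦ notᵖ (before j) ∧ᵖ onMachine σ g ⟧ p

  ¬InH⇒slow-machine : ∀ σ C k i → ¬ InH M p σ C k i →
    ∃ λ i₀ → i₀ Fin.≤ i × load M p σ i₀ < (k ℚ./ 1) * C
  ¬InH⇒slow-machine σ C k i i∉H
    with Finₚ.¬∀⟶∃¬ m _ (λ i′ → (i′ Finₚ.≤? i) →-dec ((k ℚ./ 1) * C ≤? load M p σ i′)) i∉H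
  ... | i₀ , i₀∉H with i₀ Finₚ.≤? i
  ...   | yes i₀≤i = i₀ , i₀≤i , ≰⇒> (λ kC≤L → i₀∉H (λ _ → kC≤L))
  ...   | no  i₀≰i = ⊥-elim (i₀∉H (⊥-elim ∘ i₀≰i))

  module _ (σ : Schedule n m) (nearList : NearList M p σ) where

    smallWork≤ : ∀ {a L D} θ → load M p σ a ≤ L → 0ℚ ≤ D → θ ≤ D * s a → ∀ g →
      Σ⟦ notᵖ (large θ) ∧ᵖ onMachine σ g ⟧ p ≤ (L + D) * s g
    smallWork≤ {a} {L} {D} θ La≤L 0≤D θ≤Dsa g =
      Σ⟦⟧-≤-tails (notᵖ (large θ)) (onMachine σ g) 0≤p
        (*-nonNeg 0≤L+D (<⇒≤ (positive⁻¹ (s g)))) tail≤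
      where
      0≤L+D : 0ℚ ≤ L + D
      0≤L+D = ≤-trans (≤-trans (÷-nonNeg (s a) (Σ⟦⟧-nonNeg (onMachine σ a) 0≤p)) La≤L)
                      (x≤x+y L 0≤D)

      tail≤ : ∀ j → T (not (large θ j) ∧ onMachine σ g j) →
        Σ⟦ notᵖ (before j) ∧ᵖ onMachine σ g ⟧ p ≤ (L + D) * s g
      tail≤ j small∧on with g Fin.≟ a
      ... | yes refl = begin
        Σ⟦ notᵖ (before j) ∧ᵖ onMachine σ g ⟧ p ≤⟨ Σ⟦⟧-mono 0≤p (λ l →
                                                    proj₂ ∘ Equivalence.to (T-∧ {not (before j l)})) ⟩
        work σ g                               ≤⟨ ÷≤⇒≤* (s g) La≤L ⟩
        L * s g                                ≤⟨ *-monoʳ-≤-0≤ (<⇒≤ (positive⁻¹ (s g))) (x≤x+y L 0≤D) ⟩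
        (L + D) * s g                          ∎
        where open ≤-Reasoning
      ... | no g≢a = ÷≤⇒≤* (s g) (begin
        tail ÷ s g                           ≡⟨ sym (load-loadBefore≡tail σ g j) ⟩
        load M p σ g - loadBefore M p σ g j  ≤⟨ nearList g a j (g≢a ∘ sym) (onMachine⇒≡ {σ} on) ⟩
        load M p σ a + p j ÷ s a             ≤⟨ +-mono-≤ La≤L (≤*⇒÷≤ (s a) (≤-trans pj≤θ θ≤Dsa)) ⟩
        L + D                                ∎)
        where
        open ≤-Reasoning
        tail : ℚ
        tail = Σ⟦ notᵖ (before j) ∧ᵖ onMachine σ g ⟧ p
        small×on : T (not (large θ j)) × T (onMachine σ g j)
        small×on = Equivalence.to (T-∧ {not (large θ j)}) small∧on
        on : T (onMachine σ g j)
        on = proj₂ small×on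
        pj≤θ : p j ≤ θ
        pj≤θ = small⇒≤ {θ} (proj₁ small×on)

  module Exchange (p≤1 : ∀ l → p l ≤ 1ℚ) (C : ℚ) .{{C>0 : Positive C}}
    (τ : Schedule n m) (τ-makespan : makespan M p τ ≡ C)
    (σ : Schedule n m) (nearList : NearList M p σ) where

    0≤C : 0ℚ ≤ C
    0≤C = <⇒≤ (positive⁻¹ C)

    τ-work≤ : ∀ g → work τ g ≤ C * s g
    τ-work≤ g = subst (λ c → work τ g ≤ c * s g) τ-makespan (work≤makespan*speed τ g)

    τ-p≤ : ∀ l → p l ≤ C * s (τ l)
    τ-p≤ l = subst (λ c → p l ≤ c * s (τ l)) τ-makespan (p≤makespan*speed τ l)

    module _ {a : Fin m} {L : ℚ} (La≤L : load M p σ a ≤ L) where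

      θ : ℚ
      θ = two * C * s a

      work≤largeWork+ : ∀ g → work σ g ≤ largeWork σ θ g + (L + two * C) * s g
      work≤largeWork+ g = ≤-trans (≤-reflexive (Σ⟦⟧-split (onMachine σ g) (large θ) p))
        (+-monoʳ-≤ (largeWork σ θ g) (smallWork≤ σ nearList θ La≤L (*-nonNeg 0≤two 0≤C) ≤-refl g))

      overloaded⇒largeWork-< : ∀ g → L + fromℕ 3 * C < load M p σ g →
        largeWork τ θ g < largeWork σ θ g
      overloaded⇒largeWork-< g overloaded = begin-strict
        largeWork τ θ g ≤⟨ largeWork≤work τ θ g ⟩
        work τ g        ≤⟨ τ-work≤ g ⟩
        C * s g         <⟨ +-cancelʳ-< ((L + two * C) * s g) (begin-strict
          C * s g + (L + two * C) * s g         ≡⟨ solve 3 (λ c l x → c :* x :+ (l :+ con two :* c) :* x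
                                                                    := (l :+ con (fromℕ 3) :* c) :* x)
                                                     refl C L (s g) ⟩
          (L + fromℕ 3 * C) * s g               <⟨ <÷⇒*< (s g) overloaded ⟩
          work σ g                              ≤⟨ work≤largeWork+ g ⟩
          largeWork σ θ g + (L + two * C) * s g ∎) ⟩
        largeWork σ θ g ∎
        where open ≤-Reasoning

      overloaded⇒faster-machine : ∀ h → L + fromℕ 3 * C < load M p σ h →
        ∃ λ g → two * s a < s g × load M p σ g ≤ L + fromℕ 3 * C
      overloaded⇒faster-machine h overloaded
        with Finₚ.any? (λ g → (two * s a <? s g) ×-dec (load M p σ g ≤? L + fromℕ 3 * C))
      ... | yes found = found
      ... | no  ∄g    = ⊥-elim (<-irrefl (largeWork-conserved τ σ θ)
                          (Σ-mono-< τ≤σ h (overloaded⇒largeWork-< h overloaded)))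
        where
        -- Otherwise no machine has less large work in σ than in τ, and h has more.
        τ≤σ : ∀ g → largeWork τ θ g ≤ largeWork σ θ g
        τ≤σ g with two * s a <? s g | load M p σ g ≤? L + fromℕ 3 * C
        ... | yes fast | yes light = ⊥-elim (∄g (g , fast , light))
        ... | yes _    | no  heavy = <⇒≤ (overloaded⇒largeWork-< g (≰⇒> heavy))
        ... | no  slow | _         = ≤-trans (largeWork≤0 τ θ g τ-small) (largeWork-nonNeg σ θ g)
          where
          τ-small : ∀ l → τ l ≡ g → p l ≤ θ
          τ-small l refl = begin
            p l             ≤⟨ τ-p≤ l ⟩
            C * s g         ≤⟨ *-monoˡ-≤-0≤ 0≤C (≮⇒≥ slow) ⟩
            C * (two * s a) ≡⟨ solve 3 (λ c t x → c :* (t :* x) := t :* c :* x) refl C two (s a) ⟩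
            θ               ∎
            where open ≤-Reasoning

      overloaded⇒θ<1 : ∀ h → L + fromℕ 3 * C < load M p σ h → θ < 1ℚ
      overloaded⇒θ<1 h overloaded =
        let (l , on∧large , _) = Σ⟦⟧-positive (onMachine σ h ∧ᵖ large θ) 0<largeWork
        in  <-≤-trans (large⇒< {θ} (proj₂ (Equivalence.to (T-∧ {onMachine σ h l}) on∧large)))
                      (p≤1 l)
        where
        0<largeWork : 0ℚ < largeWork σ θ h
        0<largeWork = ≤-<-trans (largeWork-nonNeg τ θ h) (overloaded⇒largeWork-< h overloaded)

    level : ℕ → ℚ
    level k = fromℕ (k ℕ.* 3 ℕ.+ 2) * C

    level-suc : ∀ k → level (suc k) ≡ level k + fromℕ 3 * C
    level-suc k = begin
      fromℕ (3 ℕ.+ (k ℕ.* 3 ℕ.+ 2)) * C      ≡⟨ cong (_* C) (fromℕ-+ 3 (k ℕ.* 3 ℕ.+ 2)) ⟩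
      (fromℕ 3 + fromℕ (k ℕ.* 3 ℕ.+ 2)) * C  ≡⟨ *-distribʳ-+ C (fromℕ 3) (fromℕ (k ℕ.* 3 ℕ.+ 2)) ⟩
      fromℕ 3 * C + level k                  ≡⟨ +-comm (fromℕ 3 * C) (level k) ⟩
      level k + fromℕ 3 * C                  ∎
      where open ≡-Reasoning

    level≤level-suc : ∀ k → level k ≤ level (suc k)
    level≤level-suc k = ≤-trans (x≤x+y (level k) (*-nonNeg (fromℕ-nonNeg 3) 0≤C))
                                (≤-reflexive (sym (level-suc k)))

    module _ {i₀ : Fin m} (Li₀≤ : load M p σ i₀ ≤ level 0) where

      doubling-chain : ∀ h k → level k < load M p σ h →
        ∃ λ a → two ^ k * s i₀ ≤ s a × load M p σ a ≤ level k
      doubling-chain h zero    _      = i₀ , ≤-reflexive (*-identityˡ (s i₀)) , Li₀≤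
      doubling-chain h (suc k) lvl<Lh
        with doubling-chain h k (≤-<-trans (level≤level-suc k) lvl<Lh)
      ... | a , 2ᵏs₀≤sa , La≤
        with overloaded⇒faster-machine La≤ h (subst (_< load M p σ h) (level-suc k) lvl<Lh)
      ...   | g , 2sa<sg , Lg≤ = g , 2ᵏ⁺¹s₀≤sg , subst (load M p σ g ≤_) (sym (level-suc k)) Lg≤
        where
        2ᵏ⁺¹s₀≤sg : two ^ suc k * s i₀ ≤ s g
        2ᵏ⁺¹s₀≤sg = <⇒≤ (≤-<-trans (≤-trans (≤-reflexive (*-assoc two (two ^ k) (s i₀)))
                                           (*-monoˡ-≤-0≤ 0≤two 2ᵏs₀≤sa))
                                  2sa<sg)

      speed-bound : ∀ K → level (suc K) < makespan M p σ → two ^ suc K * (C * s i₀) < 1ℚ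
      speed-bound K lvl<Cmax =
        let (h , lvl<Lh) = <Max⇒∃< (load M p σ) 0≤level lvl<Cmax
            (a , 2ᴷs₀≤sa , La≤) = doubling-chain h K (≤-<-trans (level≤level-suc K) lvl<Lh)
        in  begin-strict
          two ^ suc K * (C * s i₀)    ≡⟨ solve 4 (λ t u c x → (t :* u) :* (c :* x) := t :* c :* (u :* x))
                                           refl two (two ^ K) C (s i₀) ⟩
          two * C * (two ^ K * s i₀)  ≤⟨ *-monoˡ-≤-0≤ (*-nonNeg 0≤two 0≤C) 2ᴷs₀≤sa ⟩
          two * C * s a               <⟨ overloaded⇒θ<1 La≤ h (subst (_< load M p σ h) (level-suc K) lvl<Lh) ⟩
          1ℚ                          ∎
        where
        open ≤-Reasoning
        0≤level : 0ℚ ≤ level (suc K)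
        0≤level = *-nonNeg (fromℕ-nonNeg (suc K ℕ.* 3 ℕ.+ 2)) 0≤C

    job-bound : ∀ i → ¬ InH M p σ C (ℤ.+ 2) i → ∀ l → τ l ≡ i →
      ∀ K → level K < makespan M p σ → two ^ K * p l ≤ 1ℚ
    job-bound i i∉H₂ l τl≡i zero    _        = ≤-trans (≤-reflexive (*-identityˡ (p l))) (p≤1 l)
    job-bound i i∉H₂ l τl≡i (suc K) lvl<Cmax =
      let (i₀ , i₀≤i , Li₀<2C) = ¬InH⇒slow-machine σ C (ℤ.+ 2) i i∉H₂
          pl≤Cs₀ : p l ≤ C * s i₀
          pl≤Cs₀ = ≤-trans (subst (λ g → p l ≤ C * s g) τl≡i (τ-p≤ l))
                           (*-monoˡ-≤-0≤ 0≤C (speed-mon M i₀≤i))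
      in  <⇒≤ (≤-<-trans (*-monoˡ-≤-0≤ (^-nonNeg (suc K) 0≤two) pl≤Cs₀)
                         (speed-bound (<⇒≤ Li₀<2C) K lvl<Cmax))

lemma15 : ∀ {m n : ℕ} (M : Machines m) (p : Fin n → ℚ)
    → (∀ j → 0ℚ ≤ p j × p j ≤ 1ℚ)
    → (C* : ℚ) (C*-pos : ℚ.Positive C*) → IsOptimalMakespan M p C*
    → (σ : Schedule n m) → NearList M p σ
    → let c : ℤ
          c = floor ((makespan M p σ ÷ C*) {{pos⇒nonZero C* {{C*-pos}}}}) ℤ.- ℤ.1ℤ
      in ∀ (i : Fin m) → ¬ InH M p σ C* (ℤ.+ 2) i
      → ∀ (τ : Schedule n m) → makespan M p τ ≡ C*
      → ∀ (j : Fin n) → τ j ≡ i → Le2Pow (p j) c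
lemma15 M p p∈[0,1] C* C*-pos _ σ nearList i i∉H₂ τ τ-makespan j τj≡i =
  Le2Pow-floor _ (proj₁ (p∈[0,1] j)) (proj₂ (p∈[0,1] j)) λ K level<Cmax/C* →
    job-bound i i∉H₂ j τj≡i K (<÷⇒*< C* level<Cmax/C*)
  where
  instance
    C*>0 : ℚ.Positive C*
    C*>0 = C*-pos
  open Scheduling M p (proj₁ ∘ p∈[0,1])
  open Exchange (proj₂ ∘ p∈[0,1]) C* τ τ-makespan σ nearList
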